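{- For all terms $t$, the following are equivalent: (1) $\mathsf{LANG} \models \mathrm{I} \le t$, i.e., $\hat{\mathfrak{v}}(\mathrm{I}) \subseteq \hat{\mathfrak{v}}(t)$ for all language valuations $\mathfrak{v}$; (2) $\hat{\mathfrak{v}}(\mathrm{I}) \subseteq \hat{\mathfrak{v}}(t)$ for all language valuations $\mathfrak{v}$ over the empty set such that $\mathfrak{v}(x) \subseteq \{\mathrm{I}\}$ for all variables $x$.
   Context: Let $\mathbf{V}$ be a set of variables. Terms are generated by $t, s ::= x \mid \mathrm{I} \mid \bot \mid t \cdot s \mid t \cup s \mid t^{*} \mid x^{ - }$ ($x \in \mathbf{V}$). For a set $X$, a language over $X$ is a subset of $X^{*}$ (empty word $\mathrm{I}$; note $\emptyset^{*} = \{\mathrm{I}\}$). A language valuation over $X$ is a map $\mathfrak{v}$ from variables to languages over $X$, extended to terms $\hat{\mathfrak{v}}$ by $\hat{\mathfrak{v}}(\mathrm{I}) = \{\mathrm{I}\}$, $\hat{\mathfrak{v}}(\bot) = \emptyset$, $\hat{\mathfrak{v}}(t\cdot s) = \{ab \mid a \in \hat{\mathfrak{v}}(t), b \in \hat{\mathfrak{v}}(s)\}$, $\hat{\mathfrak{v}}(t \cup s) = \hat{\mathfrak{v}}(t)\cup\hat{\mathfrak{v}}(s)$, $\hat{\mathfrak{v}}(t^{*}) = \hat{\mathfrak{v}}(t)^{*}$, $\hat{\mathfrak{v}}(x^{ - }) = X^{*} \setminus \mathfrak{v}(x)$. $\mathsf{LANG} \models t \le s$ means $\hat{\mathfrak{v}}(t)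 \subseteq \hat{\mathfrak{v}}(s)$ for all language valuations over all sets. -}

module Defs where

open import Data.List using (List; []; _∷_; _++_)
open import Data.Product using (Σ; _×_; _,_; ∃-syntax)
open import Data.Sum using (_⊎_)
open import Data.Empty using (⊥)
open import Relation.Nullary using (¬_)
open import Relation.Binary.PropositionalEquality using (_≡_)

data Term (V : Set) : Set where
  var   : V → Term V
  one   : Term V
  zero  : Term V
  _·_   : Term V → Term V → Term V
  _∪_   : Term V → Term V → Term V
  _*    : Term V → Term V
  _⁻    : V → Term V

Lang : Set → Set₁
Lang X = List X → Set

Concat : {X : Set} → Lang X → Lang X → Lang X
Concat A B w = ∃[ a ] ∃[ b ] (w ≡ a ++ b × A a × B b)

data Star {X : Set} (A : Lang X) : Lang X where
  ε-in : Star A []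
  cons : ∀ {a w} → A a → Star A w → Star A (a ++ w)

Valuation : Set → Set → Set₁
Valuation V X = V → Lang X

⟦_⟧ : {V X : Set} → Term V → Valuation V X → Lang X
⟦ var x ⟧ v w = v x w
⟦ one ⟧ v w = w ≡ []
⟦ zero ⟧ v w = ⊥
⟦ t · s ⟧ v = Concat (⟦ t ⟧ v) (⟦ s ⟧ v)
⟦ t ∪ s ⟧ v w = ⟦ t ⟧ v w ⊎ ⟦ s ⟧ v w
⟦ t * ⟧ v = Star (⟦ t ⟧ v)
⟦ x ⁻ ⟧ v w = ¬ (v x w)

_⊆_ : {X : Set} → Lang X → Lang X → Set
A ⊆ B = ∀ w → A w → B w

LANG⊨I≤ : {V : Set} → Term V → Set₁
LANG⊨I≤ t = ∀ (X : Set) (v : Valuation _ X) → ⟦ one ⟧ v ⊆ ⟦ t ⟧ v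

Cond2 : {V : Set} → Term V → Set₁
Cond2 {V} t = ∀ (v : Valuation V ⊥) → (∀ x → v x ⊆ ⟦ one ⟧ v) → ⟦ one ⟧ v ⊆ ⟦ t ⟧ v

{-# OPTIONS --safe #-}
module Submission where

-- Whether the empty word lies in ⟦ t ⟧ v depends only on which v x contain the
-- empty word: a concatenation is empty only if both factors are, and the empty
-- word lies in every star. Hence v may be replaced by its trace on the empty word
-- (v x := {I} if I ∈ v x, ∅ otherwise), a valuation over ∅ bounded by {I}, and
-- condition (2) for that trace gives I ∈ ⟦ t ⟧ v.

open import Defs
open import Function.Bundles using (_⇔_; mk⇔)
open import Data.List using ([])
open import Data.List.Properties using (++-conicalˡ; ++-conicalʳ)
open import Data.Product using (_×_; _,_; proj₁)
open import Data.Sum using (inj₁; inj₂)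
open import Data.Empty renaming (⊥ to Empty)
open import Relation.Binary.PropositionalEquality using (_≡_; refl; sym; subst)

emptyWordTrace : {V X : Set} → Valuation V X → Valuation V Empty
emptyWordTrace v x w = (w ≡ []) × v x []

emptyWordTrace-⊆-one : {V X : Set} (v : Valuation V X) (x : V) →
                       emptyWordTrace v x ⊆ ⟦ one ⟧ (emptyWordTrace v)
emptyWordTrace-⊆-one v x w = proj₁

[]∈emptyWordTrace⇒[]∈⟦_⟧ : {V X : Set} (t : Term V) {v : Valuation V X} →
                          ⟦ t ⟧ (emptyWordTrace v) [] → ⟦ t ⟧ v []
[]∈emptyWordTrace⇒[]∈⟦ var x ⟧ (_ , []∈vx) = []∈vx
[]∈emptyWordTrace⇒[]∈⟦ one ⟧ _ = refl
[]∈emptyWordTrace⇒[]∈⟦ t · s ⟧ (a , b , []≡ab , a∈t , b∈s)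
  with refl ← ++-conicalˡ a b (sym []≡ab) | refl ← ++-conicalʳ a b (sym []≡ab)
  = [] , [] , refl , []∈emptyWordTrace⇒[]∈⟦ t ⟧ a∈t , []∈emptyWordTrace⇒[]∈⟦ s ⟧ b∈s
[]∈emptyWordTrace⇒[]∈⟦ t ∪ s ⟧ (inj₁ []∈t) = inj₁ ([]∈emptyWordTrace⇒[]∈⟦ t ⟧ []∈t)
[]∈emptyWordTrace⇒[]∈⟦ t ∪ s ⟧ (inj₂ []∈s) = inj₂ ([]∈emptyWordTrace⇒[]∈⟦ s ⟧ []∈s)
[]∈emptyWordTrace⇒[]∈⟦ t * ⟧ _ = ε-in
[]∈emptyWordTrace⇒[]∈⟦ x ⁻ ⟧ []∉trace []∈vx = []∉trace (refl , []∈vx)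

theorem3p3 : {V : Set} (t : Term V) → LANG⊨I≤ t ⇔ Cond2 t
theorem3p3 t = mk⇔ (λ lang v _ → lang Empty v) cond2⇒lang
  where
  cond2⇒lang : Cond2 t → LANG⊨I≤ t
  cond2⇒lang cond2 X v w w≡[] =
    subst (⟦ t ⟧ v) (sym w≡[])
      ([]∈emptyWordTrace⇒[]∈⟦ t ⟧
        (cond2 (emptyWordTrace v) (emptyWordTrace-⊆-one v) [] refl))
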